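{- Let $P \in \mathbb{Z}[x]$ be non-constant and irreducible over $\mathbb{Q}$, let $\alpha \in \mathbb{C}$ with $P(\alpha)=0$, let $p$ be a prime not dividing the leading coefficient of $P$, and let $a \in \mathbb{Z}$ with $P(a) \equiv 0 \pmod p$. Then there exists a ring homomorphism $\phi : \mathbb{Z}^p(\alpha) \to \mathbb{F}_p$ with $\phi(\alpha) = a$.
   Context: For an algebraic number $\alpha$ whose minimal polynomial over $\mathbb{Q}$ has degree $d$, every element of $\mathbb{Q}(\alpha)$ has a unique representation $q_0 + q_1\alpha + \cdots + q_{d-1}\alpha^{d-1}$ with $q_i \in \mathbb{Q}$. For a prime $p$, $\mathbb{Z}^p(\alpha)$ denotes the set of elements of $\mathbb{Q}(\alpha)$ for which none of the rational numbers $q_0,\ldots,q_{d-1}$ in this representation (in lowest terms) has denominator divisible by $p$; under the hypotheses of the claim this set is a subring of $\mathbb{Q}(\alpha)$. $\mathbb{F}_p$ denotes the integers modulo $p$. -}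

module Defs where

open import Level using (Level; _⊔_)
open import Data.Nat as ℕ using (ℕ; zero; suc)
open import Data.Nat.Properties using (_<?_)
open import Data.Fin using (Fin; zero; suc; toℕ; fromℕ; fromℕ<)
open import Data.Integer as ℤ using (ℤ; +_)
open import Data.Integer.Divisibility as ℤD using ()
open import Data.Nat.Divisibility using () renaming (_∣_ to _∣ℕ_)
open import Data.Rational as ℚ using (ℚ; 0ℚ; 1ℚ)
open import Data.List using (List; []; _∷_; map)
open import Data.Product using (Σ; ∃; _×_; _,_)
open import Data.Sum using (_⊎_)
open import Relation.Nullary using (¬_; yes; no)
open import Relation.Binary.PropositionalEquality using (_≡_)
open import Algebra.Bundles using (CommutativeRing)

sumWith : ∀ {a} {A : Set a} → (A → A → A) → A → (n : ℕ) → (Fin n → A) → A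
sumWith _+_ z zero    f = z
sumWith _+_ z (suc n) f = f zero + sumWith _+_ z n (λ i → f (suc i))

powWith : ∀ {a} {A : Set a} → (A → A → A) → A → A → ℕ → A
powWith _*_ one x zero    = one
powWith _*_ one x (suc n) = x * powWith _*_ one x n

toℚ : ℤ → ℚ
toℚ z = z ℚ./ 1

-- Integer polynomials of degree d: coefficient c i of x^i, i = 0..d
-- (the leading-coefficient condition  c (fromℕ d) ≢ 0  is imposed in
-- the statement).

coeffℤ : (d : ℕ) → (Fin (suc d) → ℤ) → ℕ → ℤ
coeffℤ d c k with k <? suc d
... | yes k<  = c (fromℕ< k<)
... | no  _   = + 0

evalℤ : (d : ℕ) → (Fin (suc d) → ℤ) → ℤ → ℤ
evalℤ d c a = sumWith ℤ._+_ (+ 0) (suc d) (λ i → c i ℤ.* (a ℤ.^ toℕ i))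

-- Rational polynomials as coefficient lists (lowest degree first),
-- compared through their coefficient functions (so trailing zeros are
-- harmless).

addℚ[x] : List ℚ → List ℚ → List ℚ
addℚ[x] []       g        = g
addℚ[x] (f ∷ fs) []       = f ∷ fs
addℚ[x] (f ∷ fs) (g ∷ gs) = (f ℚ.+ g) ∷ addℚ[x] fs gs

mulℚ[x] : List ℚ → List ℚ → List ℚ
mulℚ[x] []       g = []
mulℚ[x] (f ∷ fs) g = addℚ[x] (map (f ℚ.*_) g) (0ℚ ∷ mulℚ[x] fs g)

coeffℚ : List ℚ → ℕ → ℚ
coeffℚ []       k       = 0ℚ
coeffℚ (f ∷ fs) zero    = f
coeffℚ (f ∷ fs) (suc k) = coeffℚ fs k

IsConstantℚ[x] : List ℚ → Set
IsConstantℚ[x] f = ∀ k → coeffℚ f (suc k) ≡ 0ℚ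

-- Irreducibility over ℚ of the integer polynomial (d , c):
-- whenever it factors as F·G in ℚ[x], one of the factors is constant
-- (i.e. a unit, as the polynomial is nonzero).
IrreducibleOverℚ : (d : ℕ) → (Fin (suc d) → ℤ) → Set
IrreducibleOverℚ d c =
  ∀ (F G : List ℚ) →
    (∀ k → coeffℚ (mulℚ[x] F G) k ≡ toℚ (coeffℤ d c k)) →
    IsConstantℚ[x] F ⊎ IsConstantℚ[x] G

_∤den_ : ℕ → ℚ → Set
p ∤den q = ¬ (p ∣ℕ ℚ.denominatorℕ q)

-- Congruence modulo p in ℤ (ℤ/pℤ = 𝔽_p represented by integers)

_≡_[mod_] : ℤ → ℤ → ℕ → Set
x ≡ y [mod p ] = (+ p) ℤD.∣ (x ℤ.- y)

module _ {c ℓ : Level} (K : CommutativeRing c ℓ) where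
  open CommutativeRing K

  IsField : Set (c ⊔ ℓ)
  IsField = (¬ (0# ≈ 1#)) × (∀ x → ¬ (x ≈ 0#) → ∃ λ y → (x * y) ≈ 1#)

  IsRingHomFromℚ : (ℚ → Carrier) → Set ℓ
  IsRingHomFromℚ ι =
    (∀ q r → ι (q ℚ.+ r) ≈ (ι q + ι r)) ×
    (∀ q r → ι (q ℚ.* r) ≈ (ι q * ι r)) ×
    (ι 1ℚ ≈ 1#)

  evalK : (ℚ → Carrier) → (d : ℕ) → (Fin (suc d) → ℤ) → Carrier → Carrier
  evalK ι d cs x =
    sumWith _+_ 0# (suc d) (λ i → ι (toℚ (cs i)) * powWith _*_ 1# x (toℕ i))

  -- membership in ℤ^p(α) ⊆ ℚ(α) ⊆ K, where d = deg of the minimal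
  -- polynomial of α: x = Σ_{i<d} q_i α^i with every q_i p-integral.
  InZp : (ℚ → Carrier) → (p d : ℕ) → (α : Carrier) → Carrier → Set ℓ
  InZp ι p d α x =
    Σ (Fin d → ℚ) λ q →
      (∀ i → p ∤den q i) ×
      (x ≈ sumWith _+_ 0# d (λ i → ι (q i) * powWith _*_ 1# α (toℕ i)))

{-# OPTIONS --safe #-}
module Submission where

open import Defs
open import Level using (Level)
open import Data.Nat using (ℕ; suc; _≤_)
open import Data.Nat.Primality using (Prime)
open import Data.Fin using (Fin; fromℕ)
open import Data.Integer as ℤ using (ℤ; +_)
open import Data.Integer.Divisibility using (_∣_)
open import Data.Rational using (ℚ)
open import Data.Product using (Σ; _×_)
open import Relation.Nullary using (¬_)
open import Relation.Binary.PropositionalEquality using (_≢_)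
open import Algebra.Bundles using (CommutativeRing)
open import Data.Product using (_,_)

-- Coordinates of elements of ℚ(α) in the basis 1, α, …, α^(d-1) are unique: by
-- irreducibility of P, no nonzero rational polynomial of degree < d vanishes at α.
-- φ reduces the (p-integral) coordinates modulo p and evaluates them at a, which is
-- clearly additive. Multiplication by α acts on coordinates through the coefficients of
-- P and the inverse of its leading coefficient, which is p-integral as p ∤ lead(P);
-- reduced modulo p, and since P(a) ≡ 0, the same formula is multiplication by a.
-- Hence φ is multiplicative and sends α to a.

module QuotientRing {c ℓ ℓ′ : Level} (R : CommutativeRing c ℓ) where
  open import Algebra.Definitions using (Congruent₁; Congruent₂)
  open import Relation.Binary using (Rel; IsEquivalence; _⇒_)
  open CommutativeRing R hiding (zero)

  quotient : {_∼_ : Rel Carrier ℓ′} → IsEquivalence _∼_ → _≈_ ⇒ _∼_ →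
             Congruent₂ _∼_ _+_ → Congruent₂ _∼_ _*_ → Congruent₁ _∼_ (-_) →
             CommutativeRing c ℓ′
  quotient {_∼_} isEq ≈⇒∼ +-cong′ *-cong′ -‿cong′ = record
    { _≈_ = _∼_ ; _+_ = _+_ ; _*_ = _*_ ; -_ = -_ ; 0# = 0# ; 1# = 1#
    ; isCommutativeRing = record
      { isRing = record
        { +-isAbelianGroup = record
          { isGroup = record
            { isMonoid = record
              { isSemigroup = record
                { isMagma = record { isEquivalence = isEq ; ∙-cong = +-cong′ }
                ; assoc = λ x y z → ≈⇒∼ (+-assoc x y z) }
              ; identity = (λ x → ≈⇒∼ (+-identityˡ x)) , (λ x → ≈⇒∼ (+-identityʳ x)) }
            ; inverse = (λ x → ≈⇒∼ (-‿inverseˡ x)) , (λ x → ≈⇒∼ (-‿inverseʳ x))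
            ; ⁻¹-cong = -‿cong′ }
          ; comm = λ x y → ≈⇒∼ (+-comm x y) }
        ; *-cong = *-cong′
        ; *-assoc = λ x y z → ≈⇒∼ (*-assoc x y z)
        ; *-identity = (λ x → ≈⇒∼ (*-identityˡ x)) , (λ x → ≈⇒∼ (*-identityʳ x))
        ; distrib = (λ x y z → ≈⇒∼ (distribˡ x y z)) , (λ x y z → ≈⇒∼ (distribʳ x y z)) }
      ; *-comm = λ x y → ≈⇒∼ (*-comm x y) } }

module IntegersModulo (p : ℕ) where
  open import Data.Integer using (_+_; _*_; _-_; -_)
  import Data.Integer.Properties as ℤP
  open import Data.Integer.Divisibility.Signed as Signed
    using (divides; ∣m∣n⇒∣m+n; ∣m⇒∣-m; ∣n⇒∣m*n; ∣m⇒∣m*n; ∣ᵤ⇒∣; ∣⇒∣ᵤ)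
  open import Data.Integer.Tactic.RingSolver using (solve-∀)
  open import Relation.Binary.PropositionalEquality using (_≡_; refl; sym; subst)
  open import Relation.Binary using (IsEquivalence)
  import Relation.Binary.Reasoning.Setoid

  infix 4 p∣_
  p∣_ : ℤ → Set
  p∣ x = + p Signed.∣ x

  infix 4 _≡ₚ_
  record _≡ₚ_ (x y : ℤ) : Set where
    constructor congruent
    field p∣x-y : p∣ (x - y)

  ≡ₚ⇒≡[mod] : ∀ {x y} → x ≡ₚ y → x ≡ y [mod p ]
  ≡ₚ⇒≡[mod] (congruent p∣x-y) = ∣⇒∣ᵤ p∣x-y

  ≡[mod]⇒≡ₚ : ∀ {x y} → x ≡ y [mod p ] → x ≡ₚ y
  ≡[mod]⇒≡ₚ p∣x-y = congruent (∣ᵤ⇒∣ p∣x-y)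

  private
    p∣-resp : ∀ {x y} → x ≡ y → p∣ x → p∣ y
    p∣-resp = subst p∣_

  p∣⇒≡ₚ0 : ∀ {x} → p∣ x → x ≡ₚ + 0
  p∣⇒≡ₚ0 {x} p∣x = congruent (p∣-resp (sym (ℤP.+-identityʳ x)) p∣x)

  ≡ₚ0⇒p∣ : ∀ {x} → x ≡ₚ + 0 → p∣ x
  ≡ₚ0⇒p∣ {x} (congruent p∣x-0) = p∣-resp (ℤP.+-identityʳ x) p∣x-0

  ≡⇒≡ₚ : ∀ {x y} → x ≡ y → x ≡ₚ y
  ≡⇒≡ₚ {x} refl = congruent (divides (+ 0) (ℤP.+-inverseʳ x))

  ≡ₚ-sym : ∀ {x y} → x ≡ₚ y → y ≡ₚ x
  ≡ₚ-sym {x} {y} (congruent d) = congruent (p∣-resp (neg-diff x y) (∣m⇒∣-m d))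
    where neg-diff : ∀ x y → - (x - y) ≡ y - x
          neg-diff = solve-∀

  ≡ₚ-trans : ∀ {x y z} → x ≡ₚ y → y ≡ₚ z → x ≡ₚ z
  ≡ₚ-trans {x} {y} {z} (congruent d) (congruent e) =
    congruent (p∣-resp (telescope x y z) (∣m∣n⇒∣m+n d e))
    where telescope : ∀ x y z → (x - y) + (y - z) ≡ x - z
          telescope = solve-∀

  ≡ₚ-isEquivalence : IsEquivalence _≡ₚ_
  ≡ₚ-isEquivalence = record { refl = ≡⇒≡ₚ refl ; sym = ≡ₚ-sym ; trans = ≡ₚ-trans }

  +-cong : ∀ {x y z w} → x ≡ₚ y → z ≡ₚ w → x + z ≡ₚ y + w
  +-cong {x} {y} {z} {w} (congruent d) (congruent e) =
    congruent (p∣-resp (regroup x y z w) (∣m∣n⇒∣m+n d e))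
    where regroup : ∀ x y z w → (x - y) + (z - w) ≡ (x + z) - (y + w)
          regroup = solve-∀

  *-cong : ∀ {x y z w} → x ≡ₚ y → z ≡ₚ w → x * z ≡ₚ y * w
  *-cong {x} {y} {z} {w} (congruent d) (congruent e) =
    congruent (p∣-resp (regroup x y z w) (∣m∣n⇒∣m+n (∣m⇒∣m*n z d) (∣n⇒∣m*n y e)))
    where regroup : ∀ x y z w → (x - y) * z + y * (z - w) ≡ x * z - y * w
          regroup = solve-∀

  *-congˡ : ∀ x {y z} → y ≡ₚ z → x * y ≡ₚ x * z
  *-congˡ x = *-cong (≡⇒≡ₚ {x} refl)

  *-congʳ : ∀ z {x y} → x ≡ₚ y → x * z ≡ₚ y * z
  *-congʳ z x≡ₚy = *-cong x≡ₚy (≡⇒≡ₚ {z} refl)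

  -‿cong : ∀ {x y} → x ≡ₚ y → - x ≡ₚ - y
  -‿cong {x} {y} (congruent d) = congruent (p∣-resp (neg-diff x y) (∣m⇒∣-m d))
    where neg-diff : ∀ x y → - (x - y) ≡ - x - - y
          neg-diff = solve-∀

  𝔽ₚ : CommutativeRing _ _
  𝔽ₚ = QuotientRing.quotient ℤP.+-*-commutativeRing
         ≡ₚ-isEquivalence ≡⇒≡ₚ +-cong *-cong -‿cong

  module ≡ₚ-Reasoning = Relation.Binary.Reasoning.Setoid (CommutativeRing.setoid 𝔽ₚ)

module Polynomials {c ℓ} (R : CommutativeRing c ℓ) where
  open import Data.Nat using (zero)
  open import Data.Fin using (zero; suc; toℕ; inject₁)
  open import Data.Fin.Properties using (toℕ-inject₁; toℕ-fromℕ)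
  open import Data.Maybe using (nothing)
  open import Function using (_∘_)
  import Relation.Binary.PropositionalEquality as ≡
  open import Tactic.RingSolver.Core.AlmostCommutativeRing using (fromCommutativeRing)
  open CommutativeRing R hiding (zero)
  open import Tactic.RingSolver.NonReflective (fromCommutativeRing R (λ _ → nothing))
    using (solve; _⊜_; _⊕_; _⊗_)
  open import Relation.Binary.Reasoning.Setoid setoid
  open import Algebra.Properties.Group +-group using (inverseʳ-unique)
  open import Algebra.Properties.Ring ring using (-‿distribˡ-*; -‿distribʳ-*; -1*x≈-x)

  ∑ : (n : ℕ) → (Fin n → Carrier) → Carrier
  ∑ = sumWith _+_ 0#

  infixr 8 _^_
  _^_ : Carrier → ℕ → Carrier
  _^_ = powWith _*_ 1#

  ∑-cong : ∀ n {f g : Fin n → Carrier} → (∀ i → f i ≈ g i) → ∑ n f ≈ ∑ n g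
  ∑-cong zero    f≈g = refl
  ∑-cong (suc n) f≈g = +-cong (f≈g zero) (∑-cong n (f≈g ∘ suc))

  ∑-+ : ∀ n (f g : Fin n → Carrier) → ∑ n (λ i → f i + g i) ≈ ∑ n f + ∑ n g
  ∑-+ zero    f g = sym (+-identityˡ 0#)
  ∑-+ (suc n) f g = trans (+-cong refl (∑-+ n (f ∘ suc) (g ∘ suc)))
    (solve 4 (λ a b c d → ((a ⊕ b) ⊕ (c ⊕ d)) ⊜ ((a ⊕ c) ⊕ (b ⊕ d))) refl
       (f zero) (g zero) (∑ n (f ∘ suc)) (∑ n (g ∘ suc)))

  *-distribˡ-∑ : ∀ n k (f : Fin n → Carrier) → k * ∑ n f ≈ ∑ n (λ i → k * f i)
  *-distribˡ-∑ zero    k f = zeroʳ k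
  *-distribˡ-∑ (suc n) k f = trans (distribˡ k _ _) (+-cong refl (*-distribˡ-∑ n k (f ∘ suc)))

  ∑-last : ∀ n (f : Fin (suc n) → Carrier) → ∑ (suc n) f ≈ ∑ n (f ∘ inject₁) + f (fromℕ n)
  ∑-last zero    f = trans (+-identityʳ _) (sym (+-identityˡ _))
  ∑-last (suc n) f = trans (+-cong refl (∑-last n (f ∘ suc))) (sym (+-assoc _ _ _))

  eval : (n : ℕ) → (Fin n → Carrier) → Carrier → Carrier
  eval n v x = ∑ n (λ i → v i * x ^ toℕ i)

  module _ (x : Carrier) where

    eval-cong : ∀ n {v w : Fin n → Carrier} → (∀ i → v i ≈ w i) → eval n v x ≈ eval n w x
    eval-cong n v≈w = ∑-cong n (λ i → *-cong (v≈w i) refl)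

    eval-+ : ∀ n (v w : Fin n → Carrier) → eval n (λ i → v i + w i) x ≈ eval n v x + eval n w x
    eval-+ n v w = trans (∑-cong n (λ i → distribʳ _ (v i) (w i))) (∑-+ n _ _)

    eval-*ˡ : ∀ n k (v : Fin n → Carrier) → eval n (λ i → k * v i) x ≈ k * eval n v x
    eval-*ˡ n k v = trans (∑-cong n (λ i → *-assoc k (v i) _)) (sym (*-distribˡ-∑ n k _))

    eval-0# : ∀ n → eval n (λ _ → 0#) x ≈ 0#
    eval-0# n = trans (eval-cong n (λ _ → sym (zeroˡ 1#))) (trans (eval-*ˡ n 0# (λ _ → 1#)) (zeroˡ _))

    eval-neg : ∀ n (v : Fin n → Carrier) → eval n (λ i → - v i) x ≈ - eval n v x
    eval-neg n v = begin
      eval n (λ i → - v i) x        ≈⟨ eval-cong n (λ i → -1*x≈-x (v i)) ⟨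
      eval n (λ i → - 1# * v i) x   ≈⟨ eval-*ˡ n (- 1#) v ⟩
      - 1# * eval n v x             ≈⟨ -1*x≈-x _ ⟩
      - eval n v x                  ∎

    eval-suc : ∀ n (v : Fin (suc n) → Carrier) → eval (suc n) v x ≈ v zero + x * eval n (v ∘ suc) x
    eval-suc n v = +-cong (*-identityʳ (v zero)) (begin
      ∑ n (λ i → v (suc i) * (x * x ^ toℕ i)) ≈⟨ ∑-cong n (λ i → x∙yz≈y∙xz (v (suc i)) x _) ⟩
      ∑ n (λ i → x * (v (suc i) * x ^ toℕ i)) ≈⟨ *-distribˡ-∑ n x _ ⟨
      x * eval n (v ∘ suc) x                   ∎)
      where x∙yz≈y∙xz : ∀ a b c → a * (b * c) ≈ b * (a * c)
            x∙yz≈y∙xz = solve 3 (λ a b c → (a ⊗ (b ⊗ c)) ⊜ (b ⊗ (a ⊗ c))) refl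

    eval-last : ∀ n (v : Fin (suc n) → Carrier) →
                eval (suc n) v x ≈ eval n (v ∘ inject₁) x + v (fromℕ n) * x ^ n
    eval-last n v = trans (∑-last n (λ i → v i * x ^ toℕ i)) (+-cong
      (∑-cong n (λ i → *-cong refl (reflexive (≡.cong (x ^_) (toℕ-inject₁ i)))))
      (*-cong refl (reflexive (≡.cong (x ^_) (toℕ-fromℕ n)))))

  shift : ∀ {n} → (Fin n → Carrier) → Fin (suc n) → Carrier
  shift v zero    = 0#
  shift v (suc i) = v i

  unit : ∀ {n} → Fin (suc n) → Carrier
  unit zero    = 1#
  unit (suc i) = 0#

  eval-unit : ∀ x n → eval (suc n) unit x ≈ 1#
  eval-unit x n = begin
    eval (suc n) unit x            ≈⟨ eval-suc x n unit ⟩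
    1# + x * eval n (λ _ → 0#) x   ≈⟨ +-cong refl (*-cong refl (eval-0# x n)) ⟩
    1# + x * 0#                    ≈⟨ +-cong refl (zeroʳ x) ⟩
    1# + 0#                        ≈⟨ +-identityʳ 1# ⟩
    1#                             ∎

  -- Coordinates of x·y in the basis 1, x, …, x^(d-1) from those of y, for x a
  -- root of Σ c_i X^i and ν an inverse of c_d: the x^d term is rewritten as
  -- -ν Σ_{i<d} c_i x^i.
  module Reduction {d : ℕ} (c : Fin (suc d) → Carrier) (ν : Carrier) where

    mulX : (Fin d → Carrier) → Fin d → Carrier
    mulX v i = shift v (inject₁ i) + - (shift v (fromℕ d) * ν) * c (inject₁ i)

    polyMul : ∀ n → (Fin n → Carrier) → (Fin d → Carrier) → Fin d → Carrier
    polyMul zero    s v i = 0#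
    polyMul (suc n) s v i = s zero * v i + mulX (polyMul n (s ∘ suc) v) i

    module _ (x : Carrier) (ν*lead≈1 : ν * c (fromℕ d) ≈ 1#)
             (root : eval (suc d) c x ≈ 0#) where

      private
        lower : Carrier
        lower = eval d (c ∘ inject₁) x

        lower+top≈0 : lower + c (fromℕ d) * x ^ d ≈ 0#
        lower+top≈0 = trans (sym (eval-last x d c)) root

        reduce-top : ∀ t → - (t * ν) * lower ≈ t * x ^ d
        reduce-top t = begin
          - (t * ν) * lower                  ≈⟨ -‿distribˡ-* (t * ν) lower ⟨
          - ((t * ν) * lower)                ≈⟨ -‿distribʳ-* (t * ν) lower ⟩
          (t * ν) * - lower                  ≈⟨ *-cong refl (inverseʳ-unique lower _ lower+top≈0) ⟨
          (t * ν) * (c (fromℕ d) * x ^ d)    ≈⟨ regroup t ν (c (fromℕ d)) (x ^ d) ⟩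
          t * (ν * c (fromℕ d)) * x ^ d      ≈⟨ *-cong (*-cong refl ν*lead≈1) refl ⟩
          t * 1# * x ^ d                     ≈⟨ *-cong (*-identityʳ t) refl ⟩
          t * x ^ d                          ∎
          where
          regroup : ∀ t ν c y → (t * ν) * (c * y) ≈ t * (ν * c) * y
          regroup t ν c y = trans (*-assoc t ν (c * y))
            (trans (*-cong refl (sym (*-assoc ν c y))) (sym (*-assoc t (ν * c) y)))

      eval-mulX : ∀ v → eval d (mulX v) x ≈ x * eval d v x
      eval-mulX v = begin
        eval d (mulX v) x
          ≈⟨ eval-+ x d (shift v ∘ inject₁) _ ⟩
        eval d (shift v ∘ inject₁) x + eval d (λ i → - (top * ν) * c (inject₁ i)) x
          ≈⟨ +-cong refl (trans (eval-*ˡ x d (- (top * ν)) (c ∘ inject₁)) (reduce-top top)) ⟩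
        eval d (shift v ∘ inject₁) x + top * x ^ d
          ≈⟨ eval-last x d (shift v) ⟨
        eval (suc d) (shift v) x
          ≈⟨ eval-suc x d (shift v) ⟩
        0# + x * eval d v x
          ≈⟨ +-identityˡ _ ⟩
        x * eval d v x
          ∎
        where top = shift v (fromℕ d)

      eval-polyMul : ∀ n s v → eval d (polyMul n s v) x ≈ eval n s x * eval d v x
      eval-polyMul zero    s v = trans (eval-0# x d) (sym (zeroˡ _))
      eval-polyMul (suc n) s v = begin
        eval d (polyMul (suc n) s v) x
          ≈⟨ eval-+ x d (λ i → s zero * v i) _ ⟩
        eval d (λ i → s zero * v i) x + eval d (mulX (polyMul n (s ∘ suc) v)) x
          ≈⟨ +-cong (eval-*ˡ x d (s zero) v) (eval-mulX _) ⟩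
        s zero * eval d v x + x * eval d (polyMul n (s ∘ suc) v) x
          ≈⟨ +-cong refl (*-cong refl (eval-polyMul n (s ∘ suc) v)) ⟩
        s zero * eval d v x + x * (eval n (s ∘ suc) x * eval d v x)
          ≈⟨ factor (s zero) (eval d v x) x (eval n (s ∘ suc) x) ⟩
        (s zero + x * eval n (s ∘ suc) x) * eval d v x
          ≈⟨ *-cong (eval-suc x n s) refl ⟨
        eval (suc n) s x * eval d v x
          ∎
        where
        factor : ∀ a y x e → a * y + x * (e * y) ≈ (a + x * e) * y
        factor = solve 4 (λ a y x e → ((a ⊗ y) ⊕ (x ⊗ (e ⊗ y))) ⊜ ((a ⊕ (x ⊗ e)) ⊗ y)) refl

module RingRelation {a ℓa b ℓb} (A : CommutativeRing a ℓa) (B : CommutativeRing b ℓb) where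
  open import Level using (_⊔_)
  open import Data.Nat using (zero)
  open import Data.Fin using (zero; suc; inject₁)
  open import Function using (_∘_)
  private
    module A = CommutativeRing A
    module B = CommutativeRing B
    module PA = Polynomials A
    module PB = Polynomials B

  record IsRingRelation {r} (_∼_ : A.Carrier → B.Carrier → Set r) : Set (a ⊔ b ⊔ r) where
    field
      0∼0 : A.0# ∼ B.0#
      1∼1 : A.1# ∼ B.1#
      +-∼ : ∀ {x y u v} → x ∼ u → y ∼ v → (x A.+ y) ∼ (u B.+ v)
      *-∼ : ∀ {x y u v} → x ∼ u → y ∼ v → (x A.* y) ∼ (u B.* v)
      -‿∼ : ∀ {x u} → x ∼ u → (A.- x) ∼ (B.- u)

  module _ {r} {_∼_ : A.Carrier → B.Carrier → Set r} (rel : IsRingRelation _∼_) where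
    open IsRingRelation rel

    Pointwise : ∀ {n} → (Fin n → A.Carrier) → (Fin n → B.Carrier) → Set r
    Pointwise v w = ∀ i → v i ∼ w i

    shift-∼ : ∀ {n} {v w} → Pointwise {n} v w → Pointwise (PA.shift v) (PB.shift w)
    shift-∼ v∼w zero    = 0∼0
    shift-∼ v∼w (suc i) = v∼w i

    unit-∼ : ∀ {n} → Pointwise {suc n} PA.unit PB.unit
    unit-∼ zero    = 1∼1
    unit-∼ (suc i) = 0∼0

    module _ {d} {c c′} {ν ν′} (c∼c′ : Pointwise {suc d} c c′) (ν∼ν′ : ν ∼ ν′) where
      open PA.Reduction c ν using (mulX; polyMul)
      open PB.Reduction c′ ν′ using () renaming (mulX to mulX′; polyMul to polyMul′)

      mulX-∼ : ∀ {v w} → Pointwise v w → Pointwise (mulX v) (mulX′ w)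
      mulX-∼ v∼w i = +-∼ (shift-∼ v∼w (inject₁ i))
        (*-∼ (-‿∼ (*-∼ (shift-∼ v∼w (fromℕ d)) ν∼ν′)) (c∼c′ (inject₁ i)))

      polyMul-∼ : ∀ n {s s′ v w} → Pointwise {n} s s′ → Pointwise v w →
                  Pointwise (polyMul n s v) (polyMul′ n s′ w)
      polyMul-∼ zero    s∼s′ v∼w i = 0∼0
      polyMul-∼ (suc n) s∼s′ v∼w i =
        +-∼ (*-∼ (s∼s′ zero) (v∼w i)) (mulX-∼ (polyMul-∼ n (s∼s′ ∘ suc) v∼w) i)

module IntegersModuloPrime (p : ℕ) (p-prime : Prime p) where
  open import Data.Nat using () renaming (_+_ to _+ℕ_; _*_ to _*ℕ_)
  open import Data.Nat.Divisibility using () renaming (_∣_ to _∣ℕ_)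
  open import Data.Nat.Primality using (euclidsLemma; prime⇒irreducible)
  open import Data.Nat.Coprimality using (Coprime; coprime-Bézout)
  open import Data.Nat.GCD using (module Bézout)
  open import Data.Integer using (_+_; _*_; _-_; -_)
  import Data.Integer.Properties as ℤP
  open import Data.Integer.Divisibility.Signed using (divides; ∣ᵤ⇒∣; ∣⇒∣ᵤ)
  open import Data.Integer.Tactic.RingSolver using (solve-∀)
  open import Data.Sum using (_⊎_; inj₁; inj₂)
  open import Data.Empty using (⊥-elim)
  open import Relation.Binary.PropositionalEquality
  open IntegersModulo p

  p∣*⇒p∣⊎p∣ : ∀ x y → p∣ (x * y) → p∣ x ⊎ p∣ y
  p∣*⇒p∣⊎p∣ x y p∣xy
    with euclidsLemma ℤ.∣ x ∣ ℤ.∣ y ∣ p-prime (subst (p ∣ℕ_) (ℤP.abs-* x y) (∣⇒∣ᵤ p∣xy))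
  ... | inj₁ p∣x = inj₁ (∣ᵤ⇒∣ p∣x)
  ... | inj₂ p∣y = inj₂ (∣ᵤ⇒∣ p∣y)

  p∤*p∤⇒p∤* : ∀ {x y} → ¬ p∣ x → ¬ p∣ y → ¬ p∣ (x * y)
  p∤*p∤⇒p∤* {x} {y} p∤x p∤y p∣xy with p∣*⇒p∣⊎p∣ x y p∣xy
  ... | inj₁ p∣x = p∤x p∣x
  ... | inj₂ p∣y = p∤y p∣y

  *-cancelʳ-≡ₚ : ∀ {x y k} → ¬ p∣ k → x * k ≡ₚ y * k → x ≡ₚ y
  *-cancelʳ-≡ₚ {x} {y} {k} p∤k (congruent p∣xk-yk)
    with p∣*⇒p∣⊎p∣ (x - y) k (subst p∣_ (factor x y k) p∣xk-yk)
    where factor : ∀ x y k → x * k - y * k ≡ (x - y) * k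
          factor = solve-∀
  ... | inj₁ p∣x-y = congruent p∣x-y
  ... | inj₂ p∣k   = ⊥-elim (p∤k p∣k)

  private
    p∤⇒coprime : ∀ {m} → ¬ p ∣ℕ m → Coprime p m
    p∤⇒coprime p∤m (i∣p , i∣m) with prime⇒irreducible p-prime i∣p
    ... | inj₁ i≡1 = i≡1
    ... | inj₂ refl = ⊥-elim (p∤m i∣m)

    cast : ∀ a b c d → 1 +ℕ a *ℕ b ≡ c *ℕ d → + 1 + + a * + b ≡ + c * + d
    cast a b c d eq = begin
      + 1 + + a * + b   ≡⟨ cong (_+_ (+ 1)) (ℤP.pos-* a b) ⟨
      + (1 +ℕ a *ℕ b)   ≡⟨ cong +_ eq ⟩
      + (c *ℕ d)        ≡⟨ ℤP.pos-* c d ⟩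
      + c * + d         ∎
      where open ≡-Reasoning

  inverse : ∀ m → ¬ p ∣ℕ m → Σ ℤ λ u → + m * u ≡ₚ + 1
  inverse m p∤m with coprime-Bézout (p∤⇒coprime p∤m)
  ... | Bézout.+- x y 1+ym≡xp = - + y , congruent (divides (- + x) (begin
    + m * - + y - + 1      ≡⟨ rearrange (+ m) (+ y) ⟩
    - (+ 1 + + y * + m)    ≡⟨ cong -_ (cast y m x p 1+ym≡xp) ⟩
    - (+ x * + p)          ≡⟨ ℤP.neg-distribˡ-* (+ x) (+ p) ⟩
    - + x * + p            ∎))
    where open ≡-Reasoning
          rearrange : ∀ m y → m * - y - + 1 ≡ - (+ 1 + y * m)
          rearrange = solve-∀
  ... | Bézout.-+ x y 1+xp≡ym = + y , congruent (divides (+ x) (begin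
    + m * + y - + 1           ≡⟨ cong (_- + 1) (ℤP.*-comm (+ m) (+ y)) ⟩
    + y * + m - + 1           ≡⟨ cong (_- + 1) (cast x p y m 1+xp≡ym) ⟨
    (+ 1 + + x * + p) - + 1   ≡⟨ cancel (+ x) (+ p) ⟩
    + x * + p                 ∎))
    where open ≡-Reasoning
          cancel : ∀ a b → (+ 1 + a * b) - + 1 ≡ a * b
          cancel = solve-∀

module PIntegralRationals (p : ℕ) (p-prime : Prime p) where
  open import Data.Nat using (zero)
  open import Data.Nat.Divisibility using (∣1⇒≡1)
  open import Data.Nat.Primality using (prime⇒nonTrivial)
  open import Data.Integer using (_+_; _*_; -_; +[1+_]; -[1+_])
  import Data.Integer.Properties as ℤP
  open import Data.Integer.Divisibility.Signed using (divides; ∣ᵤ⇒∣; ∣⇒∣ᵤ)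
  open import Data.Integer.Tactic.RingSolver using (solve-∀)
  open import Data.Empty using (⊥-elim)
  open import Data.Rational as ℚ using (mkℚ; toℚᵘ; 1ℚ)
  import Data.Rational.Properties as ℚP
  open import Data.Rational.Unnormalised as ℚᵘ using (ℚᵘ; mkℚᵘ; _≃_; *≡*; ↥_; ↧_)
  import Data.Rational.Unnormalised.Properties as ℚᵘP
  open import Data.Product using (proj₁; proj₂)
  import Relation.Binary.PropositionalEquality as ≡
  open ≡ using (_≡_; _≢_)
  open IntegersModulo p
  open IntegersModuloPrime p p-prime

  -- q ∼ z: q is p-integral with residue z. Allowing any unnormalised fraction for q
  -- avoids coprimality arguments for sums, products and inverses.
  infix 4 _∼_
  record _∼_ (q : ℚ) (z : ℤ) : Set where
    constructor reduces
    field
      fraction   : ℚᵘ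
      q≃fraction : toℚᵘ q ≃ fraction
      p∤↧        : ¬ p∣ (↧ fraction)
      ↥≡z*↧      : ↥ fraction ≡ₚ z * ↧ fraction

  private
    ↧-+ : ∀ f g → ↧ (f ℚᵘ.+ g) ≡ ↧ f * ↧ g
    ↧-+ (mkℚᵘ _ m) (mkℚᵘ _ m′) = ℤP.pos-* (suc m) (suc m′)

    ↥-+ : ∀ f g → ↥ (f ℚᵘ.+ g) ≡ ↥ f * ↧ g + ↥ g * ↧ f
    ↥-+ (mkℚᵘ _ _) (mkℚᵘ _ _) = ≡.refl

    ↧-* : ∀ f g → ↧ (f ℚᵘ.* g) ≡ ↧ f * ↧ g
    ↧-* (mkℚᵘ _ m) (mkℚᵘ _ m′) = ℤP.pos-* (suc m) (suc m′)

    ↥-* : ∀ f g → ↥ (f ℚᵘ.* g) ≡ ↥ f * ↥ g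
    ↥-* (mkℚᵘ _ _) (mkℚᵘ _ _) = ≡.refl

    ↧-neg : ∀ f → ↧ (ℚᵘ.- f) ≡ ↧ f
    ↧-neg (mkℚᵘ _ _) = ≡.refl

    ↥-neg : ∀ f → ↥ (ℚᵘ.- f) ≡ - ↥ f
    ↥-neg (mkℚᵘ _ _) = ≡.refl

    p∤1 : ¬ p∣ + 1
    p∤1 p∣1 with ∣1⇒≡1 (∣⇒∣ᵤ p∣1) | prime⇒nonTrivial p-prime
    ... | ≡.refl | ()

  toℚ-∼ : ∀ z → toℚ z ∼ z
  toℚ-∼ z = reduces (mkℚᵘ z 0) (ℚP.toℚᵘ-fromℚᵘ (mkℚᵘ z 0)) p∤1
    (≡⇒≡ₚ (≡.sym (ℤP.*-identityʳ z)))

  +-∼ : ∀ {q r z w} → q ∼ z → r ∼ w → q ℚ.+ r ∼ z + w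
  +-∼ {q} {r} {z} {w} (reduces f q≃f p∤↧f ↥f≡) (reduces g r≃g p∤↧g ↥g≡) =
    reduces (f ℚᵘ.+ g) (ℚᵘP.≃-trans (ℚP.toℚᵘ-homo-+ q r) (ℚᵘP.+-cong q≃f r≃g))
      (≡.subst (λ x → ¬ p∣ x) (≡.sym (↧-+ f g)) (p∤*p∤⇒p∤* p∤↧f p∤↧g)) (begin
        ↥ (f ℚᵘ.+ g)                        ≡⟨ ↥-+ f g ⟩
        ↥ f * ↧ g + ↥ g * ↧ f               ≈⟨ +-cong (*-congʳ (↧ g) ↥f≡) (*-congʳ (↧ f) ↥g≡) ⟩
        z * ↧ f * ↧ g + w * ↧ g * ↧ f       ≡⟨ factor z w (↧ f) (↧ g) ⟩
        (z + w) * (↧ f * ↧ g)               ≡⟨ ≡.cong ((z + w) *_) (↧-+ f g) ⟨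
        (z + w) * ↧ (f ℚᵘ.+ g)              ∎)
    where open ≡ₚ-Reasoning
          factor : ∀ z w a b → z * a * b + w * b * a ≡ (z + w) * (a * b)
          factor = solve-∀

  *-∼ : ∀ {q r z w} → q ∼ z → r ∼ w → q ℚ.* r ∼ z * w
  *-∼ {q} {r} {z} {w} (reduces f q≃f p∤↧f ↥f≡) (reduces g r≃g p∤↧g ↥g≡) =
    reduces (f ℚᵘ.* g) (ℚᵘP.≃-trans (ℚP.toℚᵘ-homo-* q r) (ℚᵘP.*-cong q≃f r≃g))
      (≡.subst (λ x → ¬ p∣ x) (≡.sym (↧-* f g)) (p∤*p∤⇒p∤* p∤↧f p∤↧g)) (begin
        ↥ (f ℚᵘ.* g)                 ≡⟨ ↥-* f g ⟩
        ↥ f * ↥ g                    ≈⟨ *-cong ↥f≡ ↥g≡ ⟩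
        z * ↧ f * (w * ↧ g)          ≡⟨ regroup z w (↧ f) (↧ g) ⟩
        (z * w) * (↧ f * ↧ g)        ≡⟨ ≡.cong ((z * w) *_) (↧-* f g) ⟨
        (z * w) * ↧ (f ℚᵘ.* g)       ∎)
    where open ≡ₚ-Reasoning
          regroup : ∀ z w a b → z * a * (w * b) ≡ (z * w) * (a * b)
          regroup = solve-∀

  -‿∼ : ∀ {q z} → q ∼ z → ℚ.- q ∼ - z
  -‿∼ {q} {z} (reduces f q≃f p∤↧f ↥f≡) =
    reduces (ℚᵘ.- f) (ℚᵘP.≃-trans (ℚP.toℚᵘ-homo‿- q) (ℚᵘP.-‿cong q≃f))
      (≡.subst (λ x → ¬ p∣ x) (≡.sym (↧-neg f)) p∤↧f) (begin
        ↥ (ℚᵘ.- f)             ≡⟨ ↥-neg f ⟩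
        - ↥ f                  ≈⟨ -‿cong ↥f≡ ⟩
        - (z * ↧ f)            ≡⟨ ℤP.neg-distribˡ-* z (↧ f) ⟩
        - z * ↧ f              ≡⟨ ≡.cong (- z *_) (↧-neg f) ⟨
        - z * ↧ (ℚᵘ.- f)       ∎)
    where open ≡ₚ-Reasoning

  ∼-isRingRelation : RingRelation.IsRingRelation ℚP.+-*-commutativeRing 𝔽ₚ _∼_
  ∼-isRingRelation = record
    { 0∼0 = toℚ-∼ (+ 0) ; 1∼1 = toℚ-∼ (+ 1) ; +-∼ = +-∼ ; *-∼ = *-∼ ; -‿∼ = -‿∼ }

  ∼-unique : ∀ {q z w} → q ∼ z → q ∼ w → z ≡ₚ w
  ∼-unique {q} {z} {w} (reduces f q≃f p∤↧f ↥f≡) (reduces g q≃g p∤↧g ↥g≡)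
    with ℚᵘP.≃-trans (ℚᵘP.≃-sym q≃f) q≃g
  ... | *≡* ↥f↧g≡↥g↧f = *-cancelʳ-≡ₚ (p∤*p∤⇒p∤* p∤↧f p∤↧g) (begin
    z * (↧ f * ↧ g)      ≡⟨ ℤP.*-assoc z (↧ f) (↧ g) ⟨
    z * ↧ f * ↧ g        ≈⟨ *-congʳ (↧ g) ↥f≡ ⟨
    ↥ f * ↧ g            ≡⟨ ↥f↧g≡↥g↧f ⟩
    ↥ g * ↧ f            ≈⟨ *-congʳ (↧ f) ↥g≡ ⟩
    w * ↧ g * ↧ f        ≡⟨ regroup w (↧ g) (↧ f) ⟩
    w * (↧ f * ↧ g)      ∎)
    where open ≡ₚ-Reasoning
          regroup : ∀ w b a → w * b * a ≡ w * (a * b)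
          regroup = solve-∀

  ∼-fromFraction : ∀ {q f} → toℚᵘ q ≃ f → ¬ p∣ (↧ f) → Σ ℤ λ z → q ∼ z
  ∼-fromFraction {q} {f} q≃f p∤↧f with inverse (ℚᵘ.↧ₙ f) (λ p∣↧f → p∤↧f (∣ᵤ⇒∣ p∣↧f))
  ... | u , ↧f*u≡1 = ↥ f * u , reduces f q≃f p∤↧f (begin
    ↥ f                  ≡⟨ ℤP.*-identityʳ (↥ f) ⟨
    ↥ f * + 1            ≈⟨ *-congˡ (↥ f) ↧f*u≡1 ⟨
    ↥ f * (↧ f * u)      ≡⟨ regroup (↥ f) (↧ f) u ⟩
    ↥ f * u * ↧ f        ∎)
    where open ≡ₚ-Reasoning
          regroup : ∀ n d u → n * (d * u) ≡ n * u * d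
          regroup = solve-∀

  ∼-exists : ∀ q → p ∤den q → Σ ℤ λ z → q ∼ z
  ∼-exists (mkℚ n m _) p∤m = ∼-fromFraction ℚᵘP.≃-refl (λ p∣m → p∤m (∣⇒∣ᵤ p∣m))

  private
    ↥*↥≡↧*↧ : ∀ {f g} → f ℚᵘ.* g ≃ ℚᵘ.1ℚᵘ → ↥ f * ↥ g ≡ ↧ f * ↧ g
    ↥*↥≡↧*↧ {f} {g} (*≡* eq) = begin
      ↥ f * ↥ g              ≡⟨ ↥-* f g ⟨
      ↥ (f ℚᵘ.* g)           ≡⟨ ℤP.*-identityʳ _ ⟨
      ↥ (f ℚᵘ.* g) * + 1     ≡⟨ eq ⟩
      + 1 * ↧ (f ℚᵘ.* g)     ≡⟨ ℤP.*-identityˡ _ ⟩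
      ↧ (f ℚᵘ.* g)           ≡⟨ ↧-* f g ⟩
      ↧ f * ↧ g              ∎
      where open ≡.≡-Reasoning

    square-positive : ∀ x → x ≢ + 0 → Σ ℕ λ t → x * x ≡ + suc t
    square-positive (+ zero)  x≢0 = ⊥-elim (x≢0 ≡.refl)
    square-positive +[1+ k ]  _   = _ , ≡.refl
    square-positive -[1+ k ]  _   = _ , ≡.refl

  -- The inverse of n/d is represented by d·n/n², whose denominator is prime to p.
  ∼-inverse : ∀ {q r z} → r ℚ.* q ≡ 1ℚ → q ∼ z → ¬ p∣ z → Σ ℤ λ w → r ∼ w
  ∼-inverse {q} {r} {z} r*q≡1 (reduces f q≃f p∤↧f ↥f≡) p∤z =
    ∼-fromFraction r≃↧f↥f/↥f² p∤↥f²
    where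
    p∤↥f : ¬ p∣ ↥ f
    p∤↥f p∣↥f = p∤*p∤⇒p∤* p∤z p∤↧f
      (≡ₚ0⇒p∣ (≡ₚ-trans (≡ₚ-sym ↥f≡) (p∣⇒≡ₚ0 p∣↥f)))
    ↥f≢0 : ↥ f ≢ + 0
    ↥f≢0 ↥f≡0 = p∤↥f (≡.subst p∣_ (≡.sym ↥f≡0) (divides (+ 0) ≡.refl))
    t : ℕ
    t = proj₁ (square-positive (↥ f) ↥f≢0)
    ↥f²≡1+t : ↥ f * ↥ f ≡ + suc t
    ↥f²≡1+t = proj₂ (square-positive (↥ f) ↥f≢0)
    r′ = toℚᵘ r
    r′*f≃1 : r′ ℚᵘ.* f ≃ ℚᵘ.1ℚᵘ
    r′*f≃1 = ℚᵘP.≃-trans (ℚᵘP.*-cong (ℚᵘP.≃-refl {r′}) (ℚᵘP.≃-sym q≃f))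
               (ℚᵘP.≃-trans (ℚᵘP.≃-sym (ℚP.toℚᵘ-homo-* r q)) (ℚP.toℚᵘ-cong r*q≡1))
    r≃↧f↥f/↥f² : r′ ≃ mkℚᵘ (↧ f * ↥ f) t
    r≃↧f↥f/↥f² = *≡* (begin
      ↥ r′ * + suc t             ≡⟨ ≡.cong (↥ r′ *_) ↥f²≡1+t ⟨
      ↥ r′ * (↥ f * ↥ f)         ≡⟨ ℤP.*-assoc (↥ r′) (↥ f) (↥ f) ⟨
      ↥ r′ * ↥ f * ↥ f           ≡⟨ ≡.cong (_* ↥ f) (↥*↥≡↧*↧ {r′} {f} r′*f≃1) ⟩
      ↧ r′ * ↧ f * ↥ f           ≡⟨ regroup (↧ r′) (↧ f) (↥ f) ⟩
      ↧ f * ↥ f * ↧ r′           ∎)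
      where open ≡.≡-Reasoning
            regroup : ∀ a b c → a * b * c ≡ b * c * a
            regroup = solve-∀
    p∤↥f² : ¬ p∣ + suc t
    p∤↥f² = ≡.subst (λ x → ¬ p∣ x) ↥f²≡1+t (p∤*p∤⇒p∤* p∤↥f p∤↥f)

module RationalPolynomials where
  open import Data.Nat using (zero; _<_; z≤n; s≤s)
  import Data.Nat.Properties as ℕP
  open import Data.Rational using (0ℚ; _+_; _*_; -_; 1/_; ≢-nonZero)
  import Data.Rational.Properties as ℚP
  open import Data.Rational.Unnormalised using (mkℚᵘ; *≡*)
  import Data.Rational.Unnormalised.Properties as ℚᵘP
  import Data.Integer.Properties as ℤP
  open import Data.Fin using (zero; suc; toℕ)
  open import Data.List using (List; []; _∷_; map; tabulate)
  open import Data.Sum using (_⊎_; inj₁; inj₂)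
  open import Relation.Nullary using (yes; no)
  open import Relation.Nullary.Decidable using (dec⇒maybe)
  open import Relation.Binary.PropositionalEquality
  open import Function using (_∘_)
  open import Tactic.RingSolver.Core.AlmostCommutativeRing using (fromCommutativeRing)
  open import Tactic.RingSolver.NonReflective
    (fromCommutativeRing ℚP.+-*-commutativeRing (λ x → dec⇒maybe (0ℚ ℚP.≟ x)))
    using (solve; _⊜_; _⊕_; _⊗_; ⊝_; Κ)

  toℚ≡0⇒≡0 : ∀ z → toℚ z ≡ 0ℚ → z ≡ + 0
  toℚ≡0⇒≡0 z toℚz≡0
    with ℚᵘP.≃-trans (ℚᵘP.≃-sym (ℚP.toℚᵘ-fromℚᵘ (mkℚᵘ z 0))) (ℚP.toℚᵘ-cong toℚz≡0)
  ... | *≡* z*1≡0 = trans (sym (ℤP.*-identityʳ z)) z*1≡0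

  IsZero : List ℚ → Set
  IsZero F = ∀ k → coeffℚ F k ≡ 0ℚ

  VanishesFrom : ℕ → List ℚ → Set
  VanishesFrom b F = ∀ k → b ≤ k → coeffℚ F k ≡ 0ℚ

  HasDegree : List ℚ → ℕ → Set
  HasDegree F e = coeffℚ F e ≢ 0ℚ × (∀ k → e < k → coeffℚ F k ≡ 0ℚ)

  coeff-add : ∀ F G k → coeffℚ (addℚ[x] F G) k ≡ coeffℚ F k + coeffℚ G k
  coeff-add []      G       k       = sym (ℚP.+-identityˡ _)
  coeff-add (f ∷ F) []      zero    = sym (ℚP.+-identityʳ _)
  coeff-add (f ∷ F) []      (suc k) = sym (ℚP.+-identityʳ _)
  coeff-add (f ∷ F) (g ∷ G) zero    = refl
  coeff-add (f ∷ F) (g ∷ G) (suc k) = coeff-add F G k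

  coeff-scale : ∀ c G k → coeffℚ (map (c *_) G) k ≡ c * coeffℚ G k
  coeff-scale c []      k       = sym (ℚP.*-zeroʳ c)
  coeff-scale c (g ∷ G) zero    = refl
  coeff-scale c (g ∷ G) (suc k) = coeff-scale c G k

  coeff-mul-∷ : ∀ f F G k →
    coeffℚ (mulℚ[x] (f ∷ F) G) k ≡ f * coeffℚ G k + coeffℚ (0ℚ ∷ mulℚ[x] F G) k
  coeff-mul-∷ f F G k = trans (coeff-add (map (f *_) G) _ k)
    (cong (_+ coeffℚ (0ℚ ∷ mulℚ[x] F G) k) (coeff-scale f G k))

  coeff-mul-zeroˡ : ∀ F G → IsZero F → IsZero (mulℚ[x] F G)
  coeff-mul-zeroˡ []      G F≡0 k = refl
  coeff-mul-zeroˡ (f ∷ F) G F≡0 k = begin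
    coeffℚ (mulℚ[x] (f ∷ F) G) k                   ≡⟨ coeff-mul-∷ f F G k ⟩
    f * coeffℚ G k + coeffℚ (0ℚ ∷ mulℚ[x] F G) k
      ≡⟨ cong₂ _+_ (cong (_* coeffℚ G k) (F≡0 0)) (shifted k) ⟩
    0ℚ * coeffℚ G k + 0ℚ                           ≡⟨ cong (_+ 0ℚ) (ℚP.*-zeroˡ (coeffℚ G k)) ⟩
    0ℚ + 0ℚ                                        ≡⟨ ℚP.+-identityˡ 0ℚ ⟩
    0ℚ                                             ∎
    where open ≡-Reasoning
          shifted : IsZero (0ℚ ∷ mulℚ[x] F G)
          shifted zero    = refl
          shifted (suc k) = coeff-mul-zeroˡ F G (F≡0 ∘ suc) k

  coeff-mul-constˡ : ∀ F G → (∀ k → coeffℚ F (suc k) ≡ 0ℚ) →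
                     ∀ k → coeffℚ (mulℚ[x] F G) k ≡ coeffℚ F 0 * coeffℚ G k
  coeff-mul-constˡ []      G F-const k = sym (ℚP.*-zeroˡ (coeffℚ G k))
  coeff-mul-constˡ (f ∷ F) G F-const k = trans (coeff-mul-∷ f F G k)
    (trans (cong (_+_ (f * coeffℚ G k)) (shifted k)) (ℚP.+-identityʳ _))
    where shifted : IsZero (0ℚ ∷ mulℚ[x] F G)
          shifted zero    = refl
          shifted (suc k) = coeff-mul-zeroˡ F G F-const k

  coeff-tabulate : ∀ {n} (s : Fin n → ℚ) i → coeffℚ (tabulate s) (toℕ i) ≡ s i
  coeff-tabulate s zero    = refl
  coeff-tabulate s (suc i) = coeff-tabulate (s ∘ suc) i

  coeff-tabulate-≥ : ∀ {n} (s : Fin n → ℚ) → VanishesFrom n (tabulate s)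
  coeff-tabulate-≥ {zero}  s k       _         = refl
  coeff-tabulate-≥ {suc n} s (suc k) (s≤s n≤k) = coeff-tabulate-≥ (s ∘ suc) k n≤k

  zero-or-degree : ∀ F b → VanishesFrom b F → IsZero F ⊎ Σ ℕ λ e → e < b × HasDegree F e
  zero-or-degree F zero    F≥0≡0 = inj₁ (λ k → F≥0≡0 k z≤n)
  zero-or-degree F (suc b) F>b≡0 with coeffℚ F b ℚP.≟ 0ℚ
  ... | no  Fb≢0 = inj₂ (b , ℕP.≤-refl , Fb≢0 , F>b≡0)
  ... | yes Fb≡0 with zero-or-degree F b F≥b≡0
    where F≥b≡0 : VanishesFrom b F
          F≥b≡0 k b≤k with ℕP.m≤n⇒m<n∨m≡n b≤k
          ... | inj₁ b<k  = F>b≡0 k b<k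
          ... | inj₂ refl = Fb≡0
  ...   | inj₁ F≡0              = inj₁ F≡0
  ...   | inj₂ (e , e<b , deg) = inj₂ (e , ℕP.m<n⇒m<1+n e<b , deg)

  record Division (S R : List ℚ) (e : ℕ) : Set where
    field
      quotient remainder : List ℚ
      S≡QR+T            : ∀ k → coeffℚ S k ≡ coeffℚ (mulℚ[x] quotient R) k + coeffℚ remainder k
      remainder-small   : VanishesFrom e remainder

  -- Long division, processing S from its highest coefficient: x·(Q R + T) + s is
  -- reduced by the multiple (t / R_e)·R of R that kills its coefficient t of x^e.
  divide : ∀ {R e} → HasDegree R e → ∀ S → Division S R e
  divide {R} {e} _ [] = record
    { quotient = [] ; remainder = [] ; S≡QR+T = λ _ → sym (ℚP.+-identityˡ 0ℚ)
    ; remainder-small = λ _ _ → refl }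
  divide {R} {e} deg@(Re≢0 , R>e≡0) (s ∷ S) = record
    { quotient = c ∷ quotient ; remainder = T′ ; S≡QR+T = S≡QR+T′ ; remainder-small = T′-small }
    where
    open Division (divide {R} deg S)
    T₀ = s ∷ remainder
    t  = coeffℚ T₀ e
    c  = t * (1/ coeffℚ R e) {{≢-nonZero Re≢0}}
    T′ = addℚ[x] T₀ (map (- c *_) R)

    coeff-T′ : ∀ k → coeffℚ T′ k ≡ coeffℚ T₀ k + - c * coeffℚ R k
    coeff-T′ k = trans (coeff-add T₀ (map (- c *_) R) k) (cong (_+_ (coeffℚ T₀ k)) (coeff-scale (- c) R k))

    S≡QR+T′ : ∀ k → coeffℚ (s ∷ S) k ≡ coeffℚ (mulℚ[x] (c ∷ quotient) R) k + coeffℚ T′ k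
    S≡QR+T′ zero = sym (trans (cong₂ _+_ (coeff-mul-∷ c quotient R 0) (coeff-T′ 0))
      (solve 3 (λ c r s → (((c ⊗ r) ⊕ Κ 0ℚ) ⊕ (s ⊕ ((⊝ c) ⊗ r))) ⊜ s) refl c (coeffℚ R 0) s))
    S≡QR+T′ (suc k) = sym (trans (cong₂ _+_ (coeff-mul-∷ c quotient R (suc k)) (coeff-T′ (suc k)))
      (trans (solve 4 (λ c r m t → (((c ⊗ r) ⊕ m) ⊕ (t ⊕ ((⊝ c) ⊗ r))) ⊜ (m ⊕ t)) refl
                c (coeffℚ R (suc k)) (coeffℚ (mulℚ[x] quotient R) k) (coeffℚ remainder k))
        (sym (S≡QR+T k))))

    c*Re≡t : c * coeffℚ R e ≡ t
    c*Re≡t = trans (ℚP.*-assoc t _ (coeffℚ R e))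
      (trans (cong (_*_ t) (ℚP.*-inverseˡ (coeffℚ R e) {{≢-nonZero Re≢0}})) (ℚP.*-identityʳ t))

    T′-small : VanishesFrom e T′
    T′-small k e≤k with ℕP.m≤n⇒m<n∨m≡n e≤k
    ... | inj₂ refl = begin
      coeffℚ T′ e              ≡⟨ coeff-T′ e ⟩
      t + - c * coeffℚ R e     ≡⟨ cong (_+_ t) (ℚP.neg-distribˡ-* c (coeffℚ R e)) ⟨
      t + - (c * coeffℚ R e)   ≡⟨ cong (λ x → t + - x) c*Re≡t ⟩
      t + - t                  ≡⟨ ℚP.+-inverseʳ t ⟩
      0ℚ                       ∎
      where open ≡-Reasoning
    ... | inj₁ e<k@(s≤s e≤k′) = begin
      coeffℚ T′ k
        ≡⟨ coeff-T′ k ⟩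
      coeffℚ T₀ k + - c * coeffℚ R k
        ≡⟨ cong₂ (λ x y → x + - c * y) (remainder-small _ e≤k′) (R>e≡0 k e<k) ⟩
      0ℚ + - c * 0ℚ
        ≡⟨ solve 1 (λ c → (Κ 0ℚ ⊕ ((⊝ c) ⊗ Κ 0ℚ)) ⊜ Κ 0ℚ) refl c ⟩
      0ℚ
        ∎
      where open ≡-Reasoning

module RingHomFromℚ {c ℓ} (K : CommutativeRing c ℓ) (ι : ℚ → CommutativeRing.Carrier K)
                    (ι-hom : IsRingHomFromℚ K ι) where
  open import Data.Nat using (zero)
  open import Data.Fin using (zero; suc)
  open import Data.Rational as ℚ using (0ℚ; 1ℚ)
  import Data.Rational.Properties as ℚP
  open import Data.List using (List; []; _∷_; map; tabulate)
  open import Data.Product using (proj₁; proj₂)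
  open import Data.Maybe using (nothing)
  open import Function using (_∘_)
  import Relation.Binary.PropositionalEquality as ≡
  open ≡ using (_≡_)
  open import Relation.Nullary using (yes; no)
  open import Data.Empty using (⊥-elim)
  open CommutativeRing K hiding (zero)
  open import Relation.Binary.Reasoning.Setoid setoid
  open import Algebra.Properties.Group +-group using (identityˡ-unique; inverseʳ-unique)
  open import Tactic.RingSolver.Core.AlmostCommutativeRing using (fromCommutativeRing)
  open import Tactic.RingSolver.NonReflective (fromCommutativeRing K (λ _ → nothing))
    using (solve; _⊜_; _⊕_; _⊗_)
  open RationalPolynomials using (IsZero)

  ι-+ : ∀ q r → ι (q ℚ.+ r) ≈ ι q + ι r
  ι-+ = proj₁ ι-hom

  ι-* : ∀ q r → ι (q ℚ.* r) ≈ ι q * ι r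
  ι-* = proj₁ (proj₂ ι-hom)

  ι-1 : ι 1ℚ ≈ 1#
  ι-1 = proj₂ (proj₂ ι-hom)

  ι-0 : ι 0ℚ ≈ 0#
  ι-0 = identityˡ-unique (ι 0ℚ) (ι 0ℚ)
    (trans (sym (ι-+ 0ℚ 0ℚ)) (reflexive (≡.cong ι (ℚP.+-identityˡ 0ℚ))))

  ι-neg : ∀ q → ι (ℚ.- q) ≈ - ι q
  ι-neg q = inverseʳ-unique (ι q) (ι (ℚ.- q))
    (trans (sym (ι-+ q (ℚ.- q))) (trans (reflexive (≡.cong ι (ℚP.+-inverseʳ q))) ι-0))

  ι-isRingRelation : RingRelation.IsRingRelation ℚP.+-*-commutativeRing K (λ q y → ι q ≈ y)
  ι-isRingRelation = record
    { 0∼0 = ι-0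
    ; 1∼1 = ι-1
    ; +-∼ = λ {q} {r} ιq≈x ιr≈y → trans (ι-+ q r) (+-cong ιq≈x ιr≈y)
    ; *-∼ = λ {q} {r} ιq≈x ιr≈y → trans (ι-* q r) (*-cong ιq≈x ιr≈y)
    ; -‿∼ = λ {q} ιq≈x → trans (ι-neg q) (-‿cong ιq≈x) }

  ι≈0⇒≡0 : ¬ (0# ≈ 1#) → ∀ q → ι q ≈ 0# → q ≡ 0ℚ
  ι≈0⇒≡0 0≉1 q ιq≈0 with q ℚP.≟ 0ℚ
  ... | yes q≡0 = q≡0
  ... | no  q≢0 = ⊥-elim (0≉1 (begin
    0#                 ≈⟨ zeroʳ (ι q⁻¹) ⟨
    ι q⁻¹ * 0#         ≈⟨ *-cong refl ιq≈0 ⟨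
    ι q⁻¹ * ι q        ≈⟨ ι-* q⁻¹ q ⟨
    ι (q⁻¹ ℚ.* q)      ≡⟨ ≡.cong ι (ℚP.*-inverseˡ q {{ℚ.≢-nonZero q≢0}}) ⟩
    ι 1ℚ               ≈⟨ ι-1 ⟩
    1#                 ∎))
    where q⁻¹ = (ℚ.1/ q) {{ℚ.≢-nonZero q≢0}}

  module _ (α : Carrier) where
    open Polynomials K using (eval; eval-suc)

    evalList : List ℚ → Carrier
    evalList []      = 0#
    evalList (f ∷ F) = ι f + α * evalList F

    evalList-add : ∀ F G → evalList (addℚ[x] F G) ≈ evalList F + evalList G
    evalList-add []      G       = sym (+-identityˡ _)
    evalList-add (f ∷ F) []      = sym (+-identityʳ _)
    evalList-add (f ∷ F) (g ∷ G) = begin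
      ι (f ℚ.+ g) + α * evalList (addℚ[x] F G) ≈⟨ +-cong (ι-+ f g) (*-cong refl (evalList-add F G)) ⟩
      (ι f + ι g) + α * (evalList F + evalList G) ≈⟨ regroup (ι f) (ι g) α (evalList F) (evalList G) ⟩
      (ι f + α * evalList F) + (ι g + α * evalList G) ∎
      where regroup : ∀ a b x u v → (a + b) + x * (u + v) ≈ (a + x * u) + (b + x * v)
            regroup = solve 5 (λ a b x u v →
              ((a ⊕ b) ⊕ (x ⊗ (u ⊕ v))) ⊜ ((a ⊕ (x ⊗ u)) ⊕ (b ⊕ (x ⊗ v)))) refl

    evalList-scale : ∀ k G → evalList (map (k ℚ.*_) G) ≈ ι k * evalList G
    evalList-scale k []      = sym (zeroʳ _)
    evalList-scale k (g ∷ G) = begin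
      ι (k ℚ.* g) + α * evalList (map (k ℚ.*_) G) ≈⟨ +-cong (ι-* k g) (*-cong refl (evalList-scale k G)) ⟩
      ι k * ι g + α * (ι k * evalList G)           ≈⟨ factor (ι k) (ι g) α (evalList G) ⟩
      ι k * (ι g + α * evalList G)                 ∎
      where factor : ∀ a b x u → a * b + x * (a * u) ≈ a * (b + x * u)
            factor = solve 4 (λ a b x u → ((a ⊗ b) ⊕ (x ⊗ (a ⊗ u))) ⊜ (a ⊗ (b ⊕ (x ⊗ u)))) refl

    evalList-mul : ∀ F G → evalList (mulℚ[x] F G) ≈ evalList F * evalList G
    evalList-mul []      G = sym (zeroˡ _)
    evalList-mul (f ∷ F) G = begin
      evalList (addℚ[x] (map (f ℚ.*_) G) (0ℚ ∷ mulℚ[x] F G))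
        ≈⟨ evalList-add (map (f ℚ.*_) G) _ ⟩
      evalList (map (f ℚ.*_) G) + (ι 0ℚ + α * evalList (mulℚ[x] F G))
        ≈⟨ +-cong (evalList-scale f G) (trans (+-cong ι-0 (*-cong refl (evalList-mul F G))) (+-identityˡ _)) ⟩
      ι f * evalList G + α * (evalList F * evalList G)
        ≈⟨ factor (ι f) (evalList G) α (evalList F) ⟩
      (ι f + α * evalList F) * evalList G
        ∎
      where factor : ∀ a g x u → a * g + x * (u * g) ≈ (a + x * u) * g
            factor = solve 4 (λ a g x u → ((a ⊗ g) ⊕ (x ⊗ (u ⊗ g))) ⊜ ((a ⊕ (x ⊗ u)) ⊗ g)) refl

    evalList-zero : ∀ F → IsZero F → evalList F ≈ 0#
    evalList-zero []      F≡0 = refl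
    evalList-zero (f ∷ F) F≡0 = begin
      ι f + α * evalList F   ≈⟨ +-cong (trans (reflexive (≡.cong ι (F≡0 0))) ι-0)
                                        (*-cong refl (evalList-zero F (F≡0 ∘ suc))) ⟩
      0# + α * 0#            ≈⟨ +-identityˡ _ ⟩
      α * 0#                 ≈⟨ zeroʳ α ⟩
      0#                     ∎

    evalList-cong : ∀ F G → (∀ k → coeffℚ F k ≡ coeffℚ G k) → evalList F ≈ evalList G
    evalList-cong []      G       F≡G = sym (evalList-zero G (≡.sym ∘ F≡G))
    evalList-cong (f ∷ F) []      F≡G = evalList-zero (f ∷ F) F≡G
    evalList-cong (f ∷ F) (g ∷ G) F≡G =
      +-cong (reflexive (≡.cong ι (F≡G 0))) (*-cong refl (evalList-cong F G (F≡G ∘ suc)))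

    evalList-tabulate : ∀ n (s : Fin n → ℚ) → evalList (tabulate s) ≈ eval n (ι ∘ s) α
    evalList-tabulate zero    s = refl
    evalList-tabulate (suc n) s = sym (trans (eval-suc α n (ι ∘ s))
      (+-cong refl (*-cong refl (sym (evalList-tabulate n (s ∘ suc))))))

module _ {c ℓ} (K : CommutativeRing c ℓ) where
  open CommutativeRing K using (Carrier; _≈_; 0#; 1#)

  module Independence
    (0≉1 : ¬ (0# ≈ 1#)) (ι : ℚ → Carrier) (ι-hom : IsRingHomFromℚ K ι) (α : Carrier)
    {d : ℕ} (cs : Fin (suc d) → ℤ) (lead≢0 : cs (fromℕ d) ≢ + 0)
    (irreducible : IrreducibleOverℚ d cs) (root : evalK K ι d cs α ≈ 0#) where

    open CommutativeRing K hiding (zero; Carrier; _≈_; 0#; 1#)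

    open import Data.Nat using (zero; _<_; z≤n; s≤s)
    import Data.Nat.Properties as ℕP
    open import Data.Fin using (toℕ; fromℕ<)
    open import Data.Fin.Properties using (toℕ-fromℕ<; toℕ-fromℕ)
    open import Data.Rational using (0ℚ)
    import Data.Rational.Properties as ℚP
    open import Data.List using (List; []; _∷_; tabulate)
    open import Data.Sum using (_⊎_; inj₁; inj₂)
    open import Data.Empty using (⊥; ⊥-elim)
    open import Function using (_∘_)
    open import Relation.Nullary using (yes; no)
    import Relation.Binary.PropositionalEquality as ≡
    open ≡ using (_≡_)
    import Relation.Binary.Reasoning.Setoid as SetoidReasoning
    open RationalPolynomials
    open RingHomFromℚ K ι ι-hom

    P : List ℚ
    P = tabulate (toℚ ∘ cs)

    coeff-P : ∀ k → coeffℚ P k ≡ toℚ (coeffℤ d cs k)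
    coeff-P k with k ℕP.<? suc d
    ... | yes k≤d = ≡.subst (λ j → coeffℚ P j ≡ toℚ (cs (fromℕ< k≤d)))
                      (toℕ-fromℕ< k≤d) (coeff-tabulate (toℚ ∘ cs) (fromℕ< k≤d))
    ... | no  k≰d = coeff-tabulate-≥ (toℚ ∘ cs) k (ℕP.≮⇒≥ k≰d)

    P[α]≈0 : evalList α P ≈ 0#
    P[α]≈0 = trans (evalList-tabulate α (suc d) (toℚ ∘ cs)) root

    no-proper-factor : ∀ Q R {e} → 1 ≤ e → e < d → HasDegree R e →
                       (∀ k → coeffℚ (mulℚ[x] Q R) k ≡ coeffℚ P k) → ⊥
    no-proper-factor Q R {suc e′} _ e<d (Re≢0 , R>e≡0) QR≡P
      with irreducible Q R (λ k → ≡.trans (QR≡P k) (coeff-P k))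
    ... | inj₂ R-constant = Re≢0 (R-constant e′)
    ... | inj₁ Q-constant = lead≢0 (toℚ≡0⇒≡0 _ (begin
      toℚ (cs (fromℕ d))                  ≡⟨ coeff-tabulate (toℚ ∘ cs) (fromℕ d) ⟨
      coeffℚ P (toℕ (fromℕ d))            ≡⟨ ≡.cong (coeffℚ P) (toℕ-fromℕ d) ⟩
      coeffℚ P d                          ≡⟨ QR≡P d ⟨
      coeffℚ (mulℚ[x] Q R) d              ≡⟨ coeff-mul-constˡ Q R Q-constant d ⟩
      coeffℚ Q 0 ℚ.* coeffℚ R d           ≡⟨ ≡.cong (coeffℚ Q 0 ℚ.*_) (R>e≡0 d e<d) ⟩
      coeffℚ Q 0 ℚ.* 0ℚ                   ≡⟨ ℚP.*-zeroʳ (coeffℚ Q 0) ⟩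
      0ℚ                                  ∎))
      where open ≡.≡-Reasoning
            import Data.Rational as ℚ

    -- Induction on a bound for deg R: the remainder of P modulo R also vanishes at α
    -- and has smaller degree, and it is nonzero since P is irreducible.
    no-root-of-lower-degree : ∀ b R {e} → e < b → e < d → HasDegree R e → evalList α R ≈ 0# → ⊥
    no-root-of-lower-degree (suc b) []      {zero} _ _ (R0≢0 , _) _ = R0≢0 ≡.refl
    no-root-of-lower-degree (suc b) (r ∷ R) {zero} _ _ (r≢0 , R>0≡0) R[α]≈0 =
      r≢0 (ι≈0⇒≡0 0≉1 r (begin
        ι r                    ≈⟨ +-identityʳ (ι r) ⟨
        ι r + 0#               ≈⟨ +-cong refl (trans (*-cong refl R[α]≈0′) (zeroʳ α)) ⟨
        ι r + α * evalList α R ≈⟨ R[α]≈0 ⟩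
        0#                     ∎))
      where open SetoidReasoning setoid
            R[α]≈0′ : evalList α R ≈ 0#
            R[α]≈0′ = evalList-zero α R (λ k → R>0≡0 (suc k) (s≤s z≤n))
    no-root-of-lower-degree (suc b) R {suc e′} (s≤s e′<b) e<d deg R[α]≈0 =
      by-remainder (zero-or-degree T (suc e′) remainder-small)
      where
      open Division (divide {R} deg P) renaming (quotient to Q; remainder to T)
      open SetoidReasoning setoid

      QR+T≡P : ∀ k → coeffℚ (addℚ[x] (mulℚ[x] Q R) T) k ≡ coeffℚ P k
      QR+T≡P k = ≡.trans (coeff-add (mulℚ[x] Q R) T k) (≡.sym (S≡QR+T k))

      T[α]≈0 : evalList α T ≈ 0#
      T[α]≈0 = begin
        evalList α T                                ≈⟨ +-identityˡ _ ⟨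
        0# + evalList α T                           ≈⟨ +-cong (trans (*-cong refl R[α]≈0) (zeroʳ _)) refl ⟨
        evalList α Q * evalList α R + evalList α T  ≈⟨ +-cong (evalList-mul α Q R) refl ⟨
        evalList α (mulℚ[x] Q R) + evalList α T     ≈⟨ evalList-add α (mulℚ[x] Q R) T ⟨
        evalList α (addℚ[x] (mulℚ[x] Q R) T)        ≈⟨ evalList-cong α (addℚ[x] (mulℚ[x] Q R) T) P QR+T≡P ⟩
        evalList α P                                ≈⟨ P[α]≈0 ⟩
        0#                                          ∎

      by-remainder : IsZero T ⊎ Σ ℕ (λ j → j < suc e′ × HasDegree T j) → ⊥
      by-remainder (inj₁ T≡0) = no-proper-factor Q R (s≤s z≤n) e<d deg QR≡P
        where
        import Data.Rational as ℚ
        QR≡P : ∀ k → coeffℚ (mulℚ[x] Q R) k ≡ coeffℚ P k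
        QR≡P k = ≡.sym (≡.trans (S≡QR+T k)
          (≡.trans (≡.cong (coeffℚ (mulℚ[x] Q R) k ℚ.+_) (T≡0 k)) (ℚP.+-identityʳ _)))
      by-remainder (inj₂ (j , j<e , deg-T)) = no-root-of-lower-degree b T
        (ℕP.<-≤-trans j<e e′<b) (ℕP.<-trans j<e e<d) deg-T T[α]≈0

    independent : ∀ (r : Fin d → ℚ) → Polynomials.eval K d (ι ∘ r) α ≈ 0# → ∀ i → r i ≡ 0ℚ
    independent r r[α]≈0 i with zero-or-degree (tabulate r) d (coeff-tabulate-≥ r)
    ... | inj₁ r≡0 = ≡.trans (≡.sym (coeff-tabulate r i)) (r≡0 (toℕ i))
    ... | inj₂ (e , e<d , deg) = ⊥-elim (no-root-of-lower-degree (suc e) (tabulate r) ℕP.≤-refl e<d deg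
            (trans (evalList-tabulate α d r) r[α]≈0))

    eval-injective : ∀ (v w : Fin d → ℚ) →
      Polynomials.eval K d (ι ∘ v) α ≈ Polynomials.eval K d (ι ∘ w) α → ∀ i → v i ≡ w i
    eval-injective v w v[α]≈w[α] i =
      x∙y⁻¹≈ε⇒x≈y (v i) (w i) (independent (λ j → v j ℚ.- w j) v-w[α]≈0 i)
      where
      import Data.Rational as ℚ
      open Polynomials K using (eval; eval-cong; eval-+; eval-neg)
      open import Algebra.Properties.Group (CommutativeRing.+-group ℚP.+-*-commutativeRing)
        using (x∙y⁻¹≈ε⇒x≈y)
      open SetoidReasoning setoid
      v-w[α]≈0 : eval d (λ j → ι (v j ℚ.- w j)) α ≈ 0#
      v-w[α]≈0 = begin
        eval d (λ j → ι (v j ℚ.- w j)) α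
          ≈⟨ eval-cong α d (λ j → trans (ι-+ (v j) _) (+-cong refl (ι-neg (w j)))) ⟩
        eval d (λ j → ι (v j) + - ι (w j)) α     ≈⟨ eval-+ α d (ι ∘ v) (λ j → - ι (w j)) ⟩
        eval d (ι ∘ v) α + eval d (λ j → - ι (w j)) α ≈⟨ +-cong v[α]≈w[α] (eval-neg α d (ι ∘ w)) ⟩
        eval d (ι ∘ w) α + - eval d (ι ∘ w) α    ≈⟨ -‿inverseʳ _ ⟩
        0#                                       ∎

  module ResidueMap
    (K-field : IsField K) (ι : ℚ → Carrier) (ι-hom : IsRingHomFromℚ K ι) {d′ : ℕ}
    (cs : Fin (suc (suc d′)) → ℤ) (lead≢0 : cs (fromℕ (suc d′)) ≢ + 0)
    (irreducible : IrreducibleOverℚ (suc d′) cs)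
    (α : Carrier) (root : evalK K ι (suc d′) cs α ≈ 0#)
    (p : ℕ) (p-prime : Prime p) (p∤lead : ¬ (+ p ∣ cs (fromℕ (suc d′))))
    (a : ℤ) (P[a]≡0 : evalℤ (suc d′) cs a ≡ + 0 [mod p ]) where

    open CommutativeRing K hiding (zero; Carrier; _≈_; 0#; 1#)

    d : ℕ
    d = suc d′

    open import Data.Nat using (zero)
    open import Data.Fin using (toℕ)
    open import Data.Rational as ℚ using (1ℚ; 1/_; ≢-nonZero)
    import Data.Rational.Properties as ℚP
    import Data.Integer.Properties as ℤP
    open import Data.Integer.Divisibility.Signed using (∣⇒∣ᵤ)
    open import Data.Product using (proj₁; proj₂)
    open import Function using (_∘_)
    import Relation.Binary.PropositionalEquality as ≡
    open ≡ using (_≡_)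
    open import Relation.Binary.Reasoning.Setoid setoid
    open IntegersModulo p using (𝔽ₚ; _≡ₚ_; ≡⇒≡ₚ; ≡ₚ⇒≡[mod]; ≡[mod]⇒≡ₚ)
    open PIntegralRationals p p-prime
    open RingHomFromℚ K ι ι-hom using (ι-+; ι-*; ι-1; ι-isRingRelation)
    open Independence (proj₁ K-field) ι ι-hom α cs lead≢0 irreducible root using (eval-injective)

    private
      module 𝔽 = CommutativeRing 𝔽ₚ
      ℚ-ring = ℚP.+-*-commutativeRing
      module ℚ[X] = Polynomials ℚ-ring
      module K[X] = Polynomials K
      module 𝔽[X] = Polynomials 𝔽ₚ
      module ι = RingRelation ℚ-ring K
      module ∼ = RingRelation ℚ-ring 𝔽ₚ

      coeffs : Fin (suc d) → ℚ
      coeffs = toℚ ∘ cs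

      lead : ℚ
      lead = coeffs (fromℕ d)

      instance
        lead-nonZero : ℚ.NonZero lead
        lead-nonZero = ≢-nonZero (λ lead≡0 → lead≢0 (RationalPolynomials.toℚ≡0⇒≡0 _ lead≡0))

      ν : ℚ
      ν = 1/ lead

      ν*lead≡1 : ν ℚ.* lead ≡ 1ℚ
      ν*lead≡1 = ℚP.*-inverseˡ lead

      ν-residue : Σ ℤ (ν ∼_)
      ν-residue = ∼-inverse ν*lead≡1 (toℚ-∼ (cs (fromℕ d))) (λ p∣lead → p∤lead (∣⇒∣ᵤ p∣lead))

      u : ℤ
      u = proj₁ ν-residue

      ν∼u : ν ∼ u
      ν∼u = proj₂ ν-residue

      u*lead≡1 : u ℤ.* cs (fromℕ d) ≡ₚ + 1
      u*lead≡1 = ∼-unique (*-∼ ν∼u (toℚ-∼ (cs (fromℕ d))))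
                          (≡.subst (_∼ + 1) (≡.sym ν*lead≡1) (toℚ-∼ (+ 1)))

      ιν*lead≈1 : ι ν * ι lead ≈ 1#
      ιν*lead≈1 = trans (sym (ι-* ν lead)) (trans (reflexive (≡.cong ι ν*lead≡1)) ι-1)

      pow≡^ : ∀ k → 𝔽[X]._^_ a k ≡ a ℤ.^ k
      pow≡^ zero    = ≡.refl
      pow≡^ (suc k) = ≡.cong (a ℤ.*_) (pow≡^ k)

      P[a]≡ₚ0 : 𝔽[X].eval (suc d) cs a ≡ₚ + 0
      P[a]≡ₚ0 = 𝔽.trans (𝔽[X].∑-cong (suc d) (λ i → ≡⇒≡ₚ (≡.cong (cs i ℤ.*_) (pow≡^ (toℕ i)))))
                         (≡[mod]⇒≡ₚ P[a]≡0)

      module Rℚ = ℚ[X].Reduction coeffs ν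
      module RK = K[X].Reduction (ι ∘ coeffs) (ι ν)
      module R𝔽 = 𝔽[X].Reduction cs u

      ι-coeffs : ι.Pointwise ι-isRingRelation coeffs (ι ∘ coeffs)
      ι-coeffs i = refl

      ∼-coeffs : ∼.Pointwise ∼-isRingRelation coeffs cs
      ∼-coeffs i = toℚ-∼ (cs i)

    infix 4 _↦_
    record _↦_ (x : Carrier) (z : ℤ) : Set ℓ where
      constructor represented
      field
        coords    : Fin d → ℚ
        residues  : Fin d → ℤ
        x≈coords  : x ≈ K[X].eval d (ι ∘ coords) α
        coords∼   : ∼.Pointwise ∼-isRingRelation coords residues
        z≡ₚ       : z ≡ₚ 𝔽[X].eval d residues a

    ↦-resp-≈ : ∀ {x y z} → x ≈ y → y ↦ z → x ↦ z
    ↦-resp-≈ x≈y (represented v zs y≈v v∼zs z≡) = represented v zs (trans x≈y y≈v) v∼zs z≡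

    ↦-unique : ∀ {x z w} → x ↦ z → x ↦ w → z ≡ₚ w
    ↦-unique {x} {z} {w} (represented v zs x≈v v∼zs z≡) (represented v′ zs′ x≈v′ v′∼zs′ w≡) =
      𝔽.trans z≡ (𝔽.trans (𝔽[X].eval-cong a d zs≡ₚzs′) (𝔽.sym w≡))
      where
      v≡v′ : ∀ i → v i ≡ v′ i
      v≡v′ = eval-injective v v′ (trans (sym x≈v) x≈v′)
      zs≡ₚzs′ : ∀ i → zs i ≡ₚ zs′ i
      zs≡ₚzs′ i = ∼-unique (v∼zs i) (≡.subst (_∼ zs′ i) (≡.sym (v≡v′ i)) (v′∼zs′ i))

    ↦-+ : ∀ {x y z w} → x ↦ z → y ↦ w → x + y ↦ z ℤ.+ w
    ↦-+ {x} {y} {z} {w} (represented v zs x≈v v∼zs z≡) (represented v′ zs′ y≈v′ v′∼zs′ w≡) =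
      represented (λ i → v i ℚ.+ v′ i) (λ i → zs i ℤ.+ zs′ i) x+y≈
        (λ i → +-∼ (v∼zs i) (v′∼zs′ i))
        (𝔽.trans (𝔽.+-cong z≡ w≡) (𝔽.sym (𝔽[X].eval-+ a d zs zs′)))
      where
      x+y≈ : x + y ≈ K[X].eval d (λ i → ι (v i ℚ.+ v′ i)) α
      x+y≈ = begin
        x + y
          ≈⟨ +-cong x≈v y≈v′ ⟩
        K[X].eval d (ι ∘ v) α + K[X].eval d (ι ∘ v′) α
          ≈⟨ K[X].eval-+ α d (ι ∘ v) (ι ∘ v′) ⟨
        K[X].eval d (λ i → ι (v i) + ι (v′ i)) α
          ≈⟨ K[X].eval-cong α d (λ i → ι-+ (v i) (v′ i)) ⟨
        K[X].eval d (λ i → ι (v i ℚ.+ v′ i)) α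
          ∎

    ↦-* : ∀ {x y z w} → x ↦ z → y ↦ w → x * y ↦ z ℤ.* w
    ↦-* {x} {y} {z} {w} (represented v zs x≈v v∼zs z≡) (represented v′ zs′ y≈v′ v′∼zs′ w≡) =
      represented (Rℚ.polyMul d v v′) (R𝔽.polyMul d zs zs′) x*y≈
        (∼.polyMul-∼ ∼-isRingRelation ∼-coeffs ν∼u d v∼zs v′∼zs′)
        (𝔽.trans (𝔽.*-cong z≡ w≡) (𝔽.sym (R𝔽.eval-polyMul a u*lead≡1 P[a]≡ₚ0 d zs zs′)))
      where
      x*y≈ : x * y ≈ K[X].eval d (ι ∘ Rℚ.polyMul d v v′) α
      x*y≈ = begin
        x * y
          ≈⟨ *-cong x≈v y≈v′ ⟩
        K[X].eval d (ι ∘ v) α * K[X].eval d (ι ∘ v′) α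
          ≈⟨ RK.eval-polyMul α ιν*lead≈1 root d (ι ∘ v) (ι ∘ v′) ⟨
        K[X].eval d (RK.polyMul d (ι ∘ v) (ι ∘ v′)) α
          ≈⟨ K[X].eval-cong α d (ι.polyMul-∼ ι-isRingRelation ι-coeffs refl d
               {v} {ι ∘ v} {v′} (λ _ → refl) (λ _ → refl)) ⟨
        K[X].eval d (ι ∘ Rℚ.polyMul d v v′) α
          ∎

    1↦1 : 1# ↦ + 1
    1↦1 = represented ℚ[X].unit 𝔽[X].unit
      (trans (sym (K[X].eval-unit α d′)) (K[X].eval-cong α d (λ i → sym (ι.unit-∼ ι-isRingRelation i))))
      (∼.unit-∼ ∼-isRingRelation) (𝔽.sym (𝔽[X].eval-unit a d′))

    α↦a : α ↦ a
    α↦a = represented (Rℚ.mulX ℚ[X].unit) (R𝔽.mulX 𝔽[X].unit) α≈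
      (∼.mulX-∼ ∼-isRingRelation ∼-coeffs ν∼u (∼.unit-∼ ∼-isRingRelation)) a≡ₚ
      where
      α≈ : α ≈ K[X].eval d (ι ∘ Rℚ.mulX ℚ[X].unit) α
      α≈ = begin
        α                                          ≈⟨ *-identityʳ α ⟨
        α * 1#                                     ≈⟨ *-cong refl (K[X].eval-unit α d′) ⟨
        α * K[X].eval d K[X].unit α                ≈⟨ RK.eval-mulX α ιν*lead≈1 root K[X].unit ⟨
        K[X].eval d (RK.mulX K[X].unit) α          ≈⟨ K[X].eval-cong α d (ι.mulX-∼ ι-isRingRelation ι-coeffs refl
                                                         (ι.unit-∼ ι-isRingRelation)) ⟨
        K[X].eval d (ι ∘ Rℚ.mulX ℚ[X].unit) α      ∎
      a≡ₚ : a ≡ₚ 𝔽[X].eval d (R𝔽.mulX 𝔽[X].unit) a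
      a≡ₚ = 𝔽.sym (𝔽.trans (R𝔽.eval-mulX a u*lead≡1 P[a]≡ₚ0 𝔽[X].unit)
              (𝔽.trans (𝔽.*-congˡ {a} (𝔽[X].eval-unit a d′)) (≡⇒≡ₚ (ℤP.*-identityʳ a))))

    φ : (x : Carrier) → InZp K ι p d α x → ℤ
    φ x (q , q-integral , _) = 𝔽[X].eval d (λ i → proj₁ (∼-exists (q i) (q-integral i))) a

    ↦φ : ∀ x (mx : InZp K ι p d α x) → x ↦ φ x mx
    ↦φ x (q , q-integral , x≈q) =
      represented q _ x≈q (λ i → proj₂ (∼-exists (q i) (q-integral i))) (≡⇒≡ₚ ≡.refl)

    φ-correct : ∀ {x z} (mx : InZp K ι p d α x) → x ↦ z → φ x mx ≡ z [mod p ]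
    φ-correct {x} mx x↦z = ≡ₚ⇒≡[mod] (↦-unique (↦φ x mx) x↦z)

lemma5 : ∀ {c ℓ : Level} (K : CommutativeRing c ℓ) → IsField K →
    (ι : ℚ → CommutativeRing.Carrier K) → IsRingHomFromℚ K ι →
    (d : ℕ) (cs : Fin (suc d) → ℤ) → 1 ≤ d → cs (fromℕ d) ≢ + 0 →
    IrreducibleOverℚ d cs →
    (α : CommutativeRing.Carrier K) →
    CommutativeRing._≈_ K (evalK K ι d cs α) (CommutativeRing.0# K) →
    (p : ℕ) → Prime p → ¬ ((+ p) ∣ cs (fromℕ d)) →
    (a : ℤ) → evalℤ d cs a ≡ + 0 [mod p ] →
    let open CommutativeRing K in
    Σ ((x : Carrier) → InZp K ι p d α x → ℤ) λ φ →
      (∀ x y (mx : InZp K ι p d α x) (my : InZp K ι p d α y) →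
         x ≈ y → φ x mx ≡ φ y my [mod p ]) ×
      (∀ x y (mx : InZp K ι p d α x) (my : InZp K ι p d α y)
         (mxy : InZp K ι p d α (x + y)) →
         φ (x + y) mxy ≡ φ x mx ℤ.+ φ y my [mod p ]) ×
      (∀ x y (mx : InZp K ι p d α x) (my : InZp K ι p d α y)
         (mxy : InZp K ι p d α (x * y)) →
         φ (x * y) mxy ≡ φ x mx ℤ.* φ y my [mod p ]) ×
      (∀ (m : InZp K ι p d α 1#) → φ 1# m ≡ + 1 [mod p ]) ×
      (∀ (m : InZp K ι p d α α) → φ α m ≡ a [mod p ])
lemma5 K K-field ι ι-hom (suc d′) cs _ lead≢0 irreducible α root p p-prime p∤lead a P[a]≡0 =
  φ , (λ x y mx my x≈y → φ-correct mx (↦-resp-≈ x≈y (↦φ y my)))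
    , (λ x y mx my mxy → φ-correct mxy (↦-+ (↦φ x mx) (↦φ y my)))
    , (λ x y mx my mxy → φ-correct mxy (↦-* (↦φ x mx) (↦φ y my)))
    , (λ m → φ-correct m 1↦1)
    , (λ m → φ-correct m α↦a)
  where open ResidueMap K K-field ι ι-hom cs lead≢0 irreducible α root p p-prime p∤lead a P[a]≡0
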